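{- Let $m,n$ be integers with $0\leq n\leq m$, and let $H$ and $G$ be graphs with $\chi_G(H)=m$. Then $H$ has a subgraph $F$ with $\chi_G(F)=n$.
   Context: All graphs are finite and simple (the graph with no vertices is allowed, with $\chi_G=0$). A copy of $G$ in $H$ is a subgraph of $H$ isomorphic to $G$. A $G$-free $k$-coloring of $H$ is a map $\pi:V(H)\to\{1,\dots,k\}$ such that each induced subgraph $H[\pi^{ -1}(i)]$ contains no copy of $G$; $\chi_G(H)$ is the least $k$ for which such a coloring exists. -}

module Defs where

open import Data.Nat using (ℕ; _<_)
open import Data.Fin using (Fin)
open import Data.Bool using (Bool; true; false)
open import Data.Product using (Σ; _×_)
open import Relation.Nullary using (¬_)
open import Relation.Binary.PropositionalEquality using (_≡_)
open import Function.Definitions using (Injective)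

record Graph : Set where
  field
    V      : ℕ
    adj    : Fin V → Fin V → Bool
    sym    : ∀ i j → adj i j ≡ adj j i
    irrefl : ∀ i → adj i i ≡ false
open Graph public

-- A copy of F in H: an injective vertex map sending edges of F to edges
-- of H (its image, with the image edges, is a subgraph of H isomorphic to F).
record Copy (F H : Graph) : Set where
  field
    map      : Fin (V F) → Fin (V H)
    inj      : Injective _≡_ _≡_ map
    edge-pres : ∀ i j → adj F i j ≡ true → adj H (map i) (map j) ≡ true
open Copy public

Coloring : Graph → ℕ → Set
Coloring H k = Fin (V H) → Fin k

GFree : (G H : Graph) (k : ℕ) → Coloring H k → Set
GFree G H k π = ∀ (i : Fin k) (c : Copy G H) → ¬ (∀ v → π (map c v) ≡ i)

ChiIs : (G H : Graph) → ℕ → Set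
ChiIs G H m =
  Σ (Coloring H m) (GFree G H m) ×
  (∀ k → k < m → (π : Coloring H k) → ¬ GFree G H k π)

{-# OPTIONS --safe #-}
-- Colour H with π, a G-free m-colouring, and let F be the subgraph induced by
-- the vertices of the n smallest colours. π restricted to F is a G-free
-- n-colouring. Conversely, a G-free k-colouring of F, next to the m − n
-- remaining colour classes of π on the rest of H, would be a G-free
-- (k + m − n)-colouring of H; so k < n would contradict χ_G(H) = m.
module Submission where

open import Defs hiding (sym)
open import Data.Nat using (ℕ; _≤_; _<_; _+_; _∸_; _<?_)
open import Data.Nat.Properties
  using (≤-trans; ≤-reflexive; +-monoʳ-<; +-monoˡ-<; m+[n∸m]≡n; ∸-monoˡ-<; ≮⇒≥)
open import Data.Fin using (Fin; zero; suc; toℕ; fromℕ<; _↑ˡ_; _↑ʳ_; splitAt)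
open import Data.Fin.Properties
  using (toℕ-injective; toℕ-fromℕ<; toℕ<n; ↑ˡ-injective; ↑ʳ-injective;
         splitAt-↑ˡ; splitAt-↑ʳ; splitAt⁻¹-↑ˡ; splitAt⁻¹-↑ʳ)
open import Data.List using (List; length; lookup; filter; allFin)
import Data.List.Relation.Unary.All as All
open import Data.List.Relation.Unary.Any using (index)
open import Data.List.Relation.Unary.Any.Properties using (lookup-index)
open import Data.List.Relation.Unary.AllPairs using (_∷_)
open import Data.List.Relation.Unary.Unique.Propositional using (Unique)
open import Data.List.Relation.Unary.Unique.Propositional.Properties using (allFin⁺; filter⁺)
open import Data.List.Membership.Propositional using (_∈_)
open import Data.List.Membership.Propositional.Properties
  using (∈-lookup; ∈-allFin; ∈-filter⁺; ∈-filter⁻)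
open import Data.Product using (Σ; _×_; _,_; proj₁; proj₂)
open import Data.Sum using (inj₁; inj₂)
open import Data.Empty using (⊥-elim)
open import Relation.Nullary using (¬_; yes; no)
open import Relation.Unary using (Pred; Decidable)
open import Relation.Unary.Properties using (∁?)
open import Relation.Binary.PropositionalEquality
  using (_≡_; _≢_; refl; sym; trans; cong; subst₂)

lookup-injective : ∀ {a} {A : Set a} {xs : List A} → Unique xs →
                   ∀ {i j} → lookup xs i ≡ lookup xs j → i ≡ j
lookup-injective (_    ∷ _) {zero}  {zero}  _ = refl
lookup-injective (x∉xs ∷ _) {zero}  {suc j} e = ⊥-elim (All.lookup x∉xs (∈-lookup j) e)
lookup-injective (x∉xs ∷ _) {suc i} {zero}  e = ⊥-elim (All.lookup x∉xs (∈-lookup i) (sym e))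
lookup-injective (_    ∷ u) {suc i} {suc j} e = cong suc (lookup-injective u e)

↑ˡ≢↑ʳ : ∀ {k l} (i : Fin k) (j : Fin l) → i ↑ˡ l ≢ k ↑ʳ j
↑ˡ≢↑ʳ {k} {l} i j e
  with trans (sym (splitAt-↑ˡ k i l)) (trans (cong (splitAt k) e) (splitAt-↑ʳ k l j))
... | ()

_∘-copy_ : {G F H : Graph} → Copy G F → Copy F H → Copy G H
c ∘-copy e = record
  { map       = λ u → map e (map c u)
  ; inj       = λ eq → inj c (inj e eq)
  ; edge-pres = λ i j ij → edge-pres e _ _ (edge-pres c i j ij)
  }

module InducedSubgraph (H : Graph) {ℓ} {P : Pred (Fin (V H)) ℓ} (P? : Decidable P) where

  private
    members : List (Fin (V H))
    members = filter P? (allFin (V H))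

    member : ∀ v → P v → v ∈ members
    member v = ∈-filter⁺ P? {xs = allFin (V H)} (∈-allFin v)

  induced : Graph
  induced = record
    { V      = length members
    ; adj    = λ i j → adj H (lookup members i) (lookup members j)
    ; sym    = λ i j → Graph.sym H (lookup members i) (lookup members j)
    ; irrefl = λ i → irrefl H (lookup members i)
    }

  inclusion : Copy induced H
  inclusion = record
    { map       = lookup members
    ; inj       = lookup-injective (filter⁺ P? (allFin⁺ (V H)))
    ; edge-pres = λ _ _ ij → ij
    }

  inclusion-satisfies : ∀ i → P (map inclusion i)
  inclusion-satisfies i = proj₂ (∈-filter⁻ P? {xs = allFin (V H)} (∈-lookup i))

  index-of : ∀ v → P v → Fin (V induced)
  index-of v p = index (member v p)

  lookup-index-of : ∀ v p → map inclusion (index-of v p) ≡ v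
  lookup-index-of v p = sym (lookup-index (member v p))

  lift-copy : ∀ {G} (c : Copy G H) → (∀ u → P (map c u)) → Copy G induced
  lift-copy c inP = record
    { map       = λ u → index-of (map c u) (inP u)
    ; inj       = λ {x} {y} eq →
                    inj c (trans (sym (back x)) (trans (cong (lookup members) eq) (back y)))
    ; edge-pres = λ i j ij →
                    subst₂ (λ a b → adj H a b ≡ _) (sym (back i)) (sym (back j)) (edge-pres c i j ij)
    }
    where
    back : ∀ u → lookup members (index-of (map c u) (inP u)) ≡ map c u
    back u = lookup-index-of (map c u) (inP u)

  no-monochromatic-copy-inside : ∀ {G k} {σ : Coloring induced k} → GFree G induced k σ →
    ∀ i (c : Copy G H) → ¬ (∀ u → Σ (P (map c u)) λ p → σ (index-of (map c u) p) ≡ i)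
  no-monochromatic-copy-inside σ-free i c mono =
    σ-free i (lift-copy c (λ u → proj₁ (mono u))) (λ u → proj₂ (mono u))

open InducedSubgraph

GFree-pullback : ∀ {G F H k l} {π : Coloring H k} {ρ : Coloring F l}
                 (e : Copy F H) (f : Fin l → Fin k) → (∀ v → f (ρ v) ≡ π (map e v)) →
                 GFree G H k π → GFree G F l ρ
GFree-pullback e f commutes π-free i c mono =
  π-free (f i) (c ∘-copy e) (λ u → trans (sym (commutes (map c u))) (cong f (mono u)))

GFree-shift : ∀ {G F H k l} (π : Coloring H k) (ρ : Coloring F l) (e : Copy F H) (d : ℕ) →
              d + l ≤ k → (∀ v → d + toℕ (ρ v) ≡ toℕ (π (map e v))) →
              GFree G H k π → GFree G F l ρ
GFree-shift {k = k} π ρ e d d+l≤k commutes =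
  GFree-pullback {π = π} {ρ = ρ} e (λ j → fromℕ< (shifted< j))
    (λ v → toℕ-injective (trans (toℕ-fromℕ< _) (commutes v)))
  where
  shifted< : ∀ j → d + toℕ j < k
  shifted< j = ≤-trans (+-monoʳ-< d (toℕ<n j)) d+l≤k

module _ (H : Graph) {ℓ} {P : Pred (Fin (V H)) ℓ} (P? : Decidable P) {k l : ℕ}
         (σ : Coloring (induced H P?) k) (σ′ : Coloring (induced H (∁? P?)) l) where

  joinColoring : Coloring H (k + l)
  joinColoring v with P? v
  ... | yes p = σ (index-of H P? v p) ↑ˡ l
  ... | no ¬p = k ↑ʳ σ′ (index-of H (∁? P?) v ¬p)

  joinColoring-↑ˡ : ∀ v {i} → joinColoring v ≡ i ↑ˡ l →
                    Σ (P v) λ p → σ (index-of H P? v p) ≡ i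
  joinColoring-↑ˡ v e with P? v
  ... | yes p = p , ↑ˡ-injective l _ _ e
  ... | no _  = ⊥-elim (↑ˡ≢↑ʳ _ _ (sym e))

  joinColoring-↑ʳ : ∀ v {j} → joinColoring v ≡ k ↑ʳ j →
                    Σ (¬ P v) λ ¬p → σ′ (index-of H (∁? P?) v ¬p) ≡ j
  joinColoring-↑ʳ v e with P? v
  ... | yes _ = ⊥-elim (↑ˡ≢↑ʳ _ _ e)
  ... | no ¬p = ¬p , ↑ʳ-injective k _ _ e

  joinColoring-GFree : ∀ {G} → GFree G (induced H P?) k σ → GFree G (induced H (∁? P?)) l σ′ →
                       GFree G H (k + l) joinColoring
  joinColoring-GFree σ-free σ′-free col c mono with splitAt k col in eq
  ... | inj₁ i = no-monochromatic-copy-inside H P? {σ = σ} σ-free i c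
                   (λ u → joinColoring-↑ˡ (map c u) (trans (mono u) (sym (splitAt⁻¹-↑ˡ eq))))
  ... | inj₂ j = no-monochromatic-copy-inside H (∁? P?) {σ = σ′} σ′-free j c
                   (λ u → joinColoring-↑ʳ (map c u) (trans (mono u) (sym (splitAt⁻¹-↑ʳ eq))))

lemma3 : (m n : ℕ) → n ≤ m → (H G : Graph) → ChiIs G H m →
    Σ Graph (λ F → Copy F H × ChiIs G F n)
lemma3 m n n≤m H G ((π , π-free) , π-minimal) =
  induced H low? , inclusion H low? , (low-coloring , low-free) , no-fewer-colors
  where
  low? : Decidable (λ v → toℕ (π v) < n)
  low? v = toℕ (π v) <? n

  low-coloring : Coloring (induced H low?) n
  low-coloring i = fromℕ< (inclusion-satisfies H low? i)

  low-free : GFree G (induced H low?) n low-coloring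
  low-free = GFree-shift π low-coloring (inclusion H low?) 0 n≤m (λ _ → toℕ-fromℕ< _) π-free

  n≤high : ∀ i → n ≤ toℕ (π (map (inclusion H (∁? low?)) i))
  n≤high i = ≮⇒≥ (inclusion-satisfies H (∁? low?) i)

  high-coloring : Coloring (induced H (∁? low?)) (m ∸ n)
  high-coloring i = fromℕ< (∸-monoˡ-< (toℕ<n (π (map (inclusion H (∁? low?)) i))) (n≤high i))

  high-free : GFree G (induced H (∁? low?)) (m ∸ n) high-coloring
  high-free = GFree-shift π high-coloring (inclusion H (∁? low?)) n (≤-reflexive (m+[n∸m]≡n n≤m))
                (λ i → trans (cong (n +_) (toℕ-fromℕ< _)) (m+[n∸m]≡n (n≤high i))) π-free

  no-fewer-colors : ∀ k → k < n → (σ : Coloring (induced H low?) k) →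
                    ¬ GFree G (induced H low?) k σ
  no-fewer-colors k k<n σ σ-free =
    π-minimal (k + (m ∸ n)) (≤-trans (+-monoˡ-< (m ∸ n) k<n) (≤-reflexive (m+[n∸m]≡n n≤m)))
      (joinColoring H low? σ high-coloring)
      (joinColoring-GFree H low? σ high-coloring σ-free high-free)
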